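{- Let $\mathcal{S}=\langle W,R_Q,R_M,\rho\rangle$ be a quantum modal structure, $\Sigma$ an admissible set of formulas, and $\mathcal{S}^*$ the collapse of $\mathcal{S}$ with respect to $\Sigma$. Then for every $\alpha\in\Sigma$ and every $i\in W$: $[i]\models_{\mathcal{S}^*}\alpha$ if and only if $i\models_{\mathcal{S}}\alpha$.
   Context: Formulas are built from a countable set of atomic formulas using $\wedge$, $\neg$, $\Box$. A quantum modal structure is a quadruple $\langle W,R_Q,R_M,\rho\rangle$ where: $W$ is non-empty; $R_Q$ is reflexive and symmetric on $W$; $R_M$ is a binary relation on $W$ such that $R_M(i,l)$ and $R_Q(i,j)$ imply $R_M(j,l)$; $\rho$ assigns to each atomic formula an $R_Q$-closed subset $X\subseteq W$ ($i\in X$ iff for every $j$ with $R_Q(i,j)$ there is $k$ with $R_Q(j,k)$ and $k\in X$). Truth: $i\models p$ iff $i\in\rho(p)$; $i\models\alpha\wedge\beta$ iff $i\models\alpha$ and $i\models\beta$; $i\models\neg\alpha$ iff for all $j$ with $R_Q(i,j)$, $j\not\models\alpha$; $i\models\Box\alpha$ iff for all $l$ with $R_M(i,l)$, $l\models\alpha$. $\Sigma$ is admissible if closed under subformulas and $\neg p\in\Sigma$ for each atomic $p\in\Sigma$. Define $i\sim j$ iff $i,j$ satisfy in $\mathcal{S}$ exactly the same formulas of $\Sigma$, with classes $[i]$. The collapse $\mathcal{S}^*=\langle W^*,R_Q^*,R_M^*,\rho^*\rangle$: $W^*=W/\sim$; $R_Q^*([i],[j])$ iff $R_Q(i',j')$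 for some $i'\in[i]$, $j'\in[j]$; $R_M^*([i],[l])$ iff for every $\Box\alpha\in\Sigma$, $i\models_{\mathcal{S}}\Box\alpha$ implies $l\models_{\mathcal{S}}\alpha$; $\rho^*(p)=\{[i]:i\in\rho(p)\}$ if $p\in\Sigma$ and $\emptyset$ otherwise. -}

module Defs where

open import Data.Nat using (ℕ)
open import Data.Product using (Σ; ∃; _×_; _,_)
open import Data.Empty using (⊥)
open import Relation.Nullary using (¬_)
open import Function.Bundles using (_⇔_)

data Formula : Set where
  atom : ℕ → Formula
  _∧_  : Formula → Formula → Formula
  neg  : Formula → Formula
  box  : Formula → Formula

record Model : Set₁ where
  field
    W   : Set
    RQ  : W → W → Set
    RM  : W → W → Set
    ρ   : ℕ → W → Set

_⊨_at_ : (M : Model) → Model.W M → Formula → Set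
M ⊨ i at atom p  = Model.ρ M p i
M ⊨ i at (α ∧ β) = (M ⊨ i at α) × (M ⊨ i at β)
M ⊨ i at neg α   = ∀ j → Model.RQ M i j → ¬ (M ⊨ j at α)
M ⊨ i at box α   = ∀ l → Model.RM M i l → M ⊨ l at α

RQ-closed : (M : Model) → (Model.W M → Set) → Set
RQ-closed M X =
  ∀ i → X i ⇔ (∀ j → Model.RQ M i j → ∃ λ k → Model.RQ M j k × X k)

record QMS : Set₁ where
  field
    model    : Model
  open Model model public
  field
    RQ-refl  : ∀ i → RQ i i
    RQ-sym   : ∀ i j → RQ i j → RQ j i
    RM-RQ    : ∀ i j l → RM i l → RQ i j → RM j l
    ρ-closed : ∀ p → RQ-closed model (ρ p)

record Admissible (Γ : Formula → Set) : Set where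
  field
    sub-∧ˡ : ∀ α β → Γ (α ∧ β) → Γ α
    sub-∧ʳ : ∀ α β → Γ (α ∧ β) → Γ β
    sub-¬  : ∀ α → Γ (neg α) → Γ α
    sub-□  : ∀ α → Γ (box α) → Γ α
    atom-¬ : ∀ p → Γ (atom p) → Γ (neg (atom p))

module _ (S : QMS) (Γ : Formula → Set) where
  open QMS S

  _∼_ : W → W → Set
  i ∼ j = ∀ α → Γ α → (model ⊨ i at α) ⇔ (model ⊨ j at α)

  -- Since Agda has no quotient types, an
  -- element [i] of W* = W/∼ is represented by any representative i ∈ W;
  -- all relations below are defined exactly as in the paper (in terms of
  -- representatives) and are ∼-invariant.
  collapse : Model
  collapse = record
    { W  = W
    ; RQ = λ i j → Σ W λ i' → Σ W λ j' → (i' ∼ i) × (j' ∼ j) × RQ i' j'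
    ; RM = λ i l → ∀ α → Γ (box α) → model ⊨ i at box α → model ⊨ l at α
    ; ρ  = λ p i → Γ (atom p) × (Σ W λ i' → (i' ∼ i) × ρ p i')
    }

{-# OPTIONS --safe #-}
module Submission where

-- Since ∼ identifies points agreeing on Σ,
-- any representative may stand in for [i] on formulas of Σ: this handles the
-- atoms and, because ¬α ∈ Σ, lets R_Q* between classes be pulled back to R_Q
-- between representatives. R_M* is defined precisely so that the □-case holds.

open import Defs
open import Data.Product using (_,_)
open import Data.Product.Function.NonDependent.Propositional using (_×-⇔_)
open import Function.Bundles using (_⇔_; mk⇔; Equivalence)
open import Function.Properties.Equivalence using () renaming (refl to ⇔-refl)

module Collapse (S : QMS) (Γ : Formula → Set) where
  open QMS S
  open Equivalence

  ∼-refl : ∀ i → _∼_ S Γ i i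
  ∼-refl i α _ = ⇔-refl

  collapse-⊨-atom : ∀ p i → Γ (atom p) →
                    (collapse S Γ ⊨ i at atom p) ⇔ (model ⊨ i at atom p)
  collapse-⊨-atom p i Γp = mk⇔
    (λ { (_ , i' , i'∼i , i'⊨p) → to (i'∼i (atom p) Γp) i'⊨p })
    (λ i⊨p → Γp , i , ∼-refl i , i⊨p)

  collapse-⊨-neg : ∀ α i → Γ (neg α) → Γ α →
                   (∀ j → (collapse S Γ ⊨ j at α) ⇔ (model ⊨ j at α)) →
                   (collapse S Γ ⊨ i at neg α) ⇔ (model ⊨ i at neg α)
  collapse-⊨-neg α i Γ¬α Γα ih = mk⇔
    (λ i⊨*¬α j RQij j⊨α →
       i⊨*¬α j (i , j , ∼-refl i , ∼-refl j , RQij) (from (ih j) j⊨α))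
    (λ { i⊨¬α j (i' , j' , i'∼i , j'∼j , RQi'j') j⊨*α →
       from (i'∼i (neg α) Γ¬α) i⊨¬α j' RQi'j' (from (j'∼j α Γα) (to (ih j) j⊨*α)) })

  collapse-⊨-box : ∀ α i → Γ (box α) →
                   (∀ l → (collapse S Γ ⊨ l at α) ⇔ (model ⊨ l at α)) →
                   (collapse S Γ ⊨ i at box α) ⇔ (model ⊨ i at box α)
  collapse-⊨-box α i Γ□α ih = mk⇔
    (λ i⊨*□α l RMil → to (ih l) (i⊨*□α l (λ β _ i⊨□β → i⊨□β l RMil)))
    (λ i⊨□α l RM*il → from (ih l) (RM*il α Γ□α i⊨□α))

lemma3 : (S : QMS) (Γ : Formula → Set) → Admissible Γ →
    ∀ α → Γ α → ∀ (i : QMS.W S) →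
    (collapse S Γ ⊨ i at α) ⇔ (QMS.model S ⊨ i at α)
lemma3 S Γ A (atom p) Γp i = Collapse.collapse-⊨-atom S Γ p i Γp
lemma3 S Γ A (α ∧ β) Γα∧β i =
  lemma3 S Γ A α (Admissible.sub-∧ˡ A α β Γα∧β) i
    ×-⇔ lemma3 S Γ A β (Admissible.sub-∧ʳ A α β Γα∧β) i
lemma3 S Γ A (neg α) Γ¬α i = Collapse.collapse-⊨-neg S Γ α i Γ¬α Γα
  (lemma3 S Γ A α Γα)
  where Γα = Admissible.sub-¬ A α Γ¬α
lemma3 S Γ A (box α) Γ□α i = Collapse.collapse-⊨-box S Γ α i Γ□α
  (lemma3 S Γ A α (Admissible.sub-□ A α Γ□α))
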